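{- Let $G=(V,E)$ be a graph and $k\ge 0$ an integer such that (i) every critical clique of $G$ has at most $k+1$ vertices, and (ii) there is no comb $(C,R)$ of $G$ (with ordered partition $(C_1,\dots,C_l)$ of $C$) admitting disjoint sets $\mathcal{C}_a$, $\mathcal{C}_b$, where $\mathcal{C}_a$ is a $(2k+1)$-packing of $(C_1,\dots,C_l)$ and $\mathcal{C}_b$ is a $(2k+1)$-packing of $(C_l,\dots,C_1)$, such that $C\setminus(\mathcal{C}_a\cup\mathcal{C}_b)\neq\emptyset$. Then every comb $(C,R)$ of $G$ satisfies $|C|\le 6k+2$.
   Context: Graphs are finite, simple, undirected; $N_G(X)=\bigcup_{v\in X}N_G(v)\setminus X$. A graph is trivially perfect if it has no induced $C_4$ and no induced $P_4$. A module is a set $M$ with $N(u)\setminus M=N(v)\setminus M$ for all $u,v\in M$; a critical clique is a maximal set of vertices pairwise satisfying $N[u]=N[v]$. A comb of $G$ is a pair $(C,R)$ of disjoint vertex subsets such that: $G[C]$ is a clique partitioned into $l$ critical cliques $C_1,\dots,C_l$ of $G$; $R$ is partitioned into $l$ nonempty, pairwise non-adjacent modules $R_1,\dots,R_l$ of $G$ each inducing a trivially perfect graph; $N_G(C_i)\cap R=\bigcup_{j=i}^l R_j$ and $N_G(R_i)\cap C=\bigcup_{j=1}^i C_j$ for $1\le i\le l$; and there exist (possibly empty) sets $V_f,V_p\subseteq V\setminus(C\cup R)$ with $N_G(x)\setminus(C\cup R)=V_p\cup V_f$ for all $x\in C$ and $N_G(y)\setminus(C\cup R)=V_p$ for all $y\in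 R$. Given an ordered collection $(S_1,\dots,S_q)$ of pairwise disjoint vertex sets and integer $r$, an $r$-packing is a prefix $\{S_1,\dots,S_p\}$ with $\sum_{i\le p}|S_i|\ge r$ and minimum number of vertices for this property, identified with its union. Condition (ii) expresses that the reduction rule deleting $C\setminus(\mathcal{C}_a\cup\mathcal{C}_b)$ does not apply. -}

module Defs where

open import Data.Nat using (ℕ; zero; suc; _+_; _≤_; _<_)
open import Data.Bool using (Bool; true; false; _∨_)
open import Data.Fin using (Fin; toℕ; opposite; _≟_)
open import Data.Fin.Subset using (Subset; _∈_; _∉_; ∣_∣)
open import Data.Product using (Σ; ∃; ∃-syntax; _×_; _,_)
open import Data.Sum using (_⊎_)
open import Relation.Binary.PropositionalEquality using (_≡_; _≢_)
open import Relation.Nullary using (¬_; does)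
open import Function.Bundles using (_⇔_)

record Graph (n : ℕ) : Set where
  field
    adj     : Fin n → Fin n → Bool
    adj-sym : ∀ u v → adj u v ≡ adj v u
    irrefl  : ∀ u → adj u u ≡ false

module _ {n : ℕ} (G : Graph n) where
  open Graph G

  Adj : Fin n → Fin n → Set
  Adj u v = adj u v ≡ true

  closedAdj : Fin n → Fin n → Bool
  closedAdj u x = does (u ≟ x) ∨ adj u x

  SameClosedNbhd : Fin n → Fin n → Set
  SameClosedNbhd u v = ∀ x → closedAdj u x ≡ closedAdj v x

  IsCriticalClique : Subset n → Set
  IsCriticalClique K =
    (∀ u v → u ∈ K → v ∈ K → SameClosedNbhd u v) ×
    (∀ (K' : Subset n) → (∀ x → x ∈ K → x ∈ K') →
       (∀ u v → u ∈ K' → v ∈ K' → SameClosedNbhd u v) → ∀ x → x ∈ K' → x ∈ K)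

  IsClique : Subset n → Set
  IsClique K = ∀ u v → u ∈ K → v ∈ K → u ≢ v → Adj u v

  IsModule : Subset n → Set
  IsModule M = ∀ u v x → u ∈ M → v ∈ M → x ∉ M → adj u x ≡ adj v x

  InducedP4In : Subset n → Set
  InducedP4In M = Σ (Fin n) λ a → Σ (Fin n) λ b → Σ (Fin n) λ c → Σ (Fin n) λ d →
    (a ∈ M × b ∈ M × c ∈ M × d ∈ M) ×
    (a ≢ b × a ≢ c × a ≢ d × b ≢ c × b ≢ d × c ≢ d) ×
    (Adj a b × Adj b c × Adj c d) ×
    (¬ Adj a c × ¬ Adj b d × ¬ Adj a d)

  InducedC4In : Subset n → Set
  InducedC4In M = Σ (Fin n) λ a → Σ (Fin n) λ b → Σ (Fin n) λ c → Σ (Fin n) λ d →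
    (a ∈ M × b ∈ M × c ∈ M × d ∈ M) ×
    (a ≢ b × a ≢ c × a ≢ d × b ≢ c × b ≢ d × c ≢ d) ×
    (Adj a b × Adj b c × Adj c d × Adj d a) ×
    (¬ Adj a c × ¬ Adj b d)

  TriviallyPerfectOn : Subset n → Set
  TriviallyPerfectOn M = ¬ InducedC4In M × ¬ InducedP4In M

  -- A comb (C, R) together with its ordered partitions (C₁,…,C_l), (R₁,…,R_l).
  -- Indices 1..l of the paper are Fin l (0-based); "j ≥ i" is toℕ i ≤ toℕ j.
  record Comb : Set where
    field
      C R : Subset n
      l   : ℕ
      Cs Rs : Fin l → Subset n
      C-R-disjoint : ∀ x → x ∈ C → x ∉ R
      C-clique     : IsClique C
      C-partition  : ∀ x → (x ∈ C) ⇔ (∃[ i ] x ∈ Cs i)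
      Cs-disjoint  : ∀ i j x → i ≢ j → x ∈ Cs i → x ∉ Cs j
      Cs-critical  : ∀ i → IsCriticalClique (Cs i)
      R-partition  : ∀ x → (x ∈ R) ⇔ (∃[ i ] x ∈ Rs i)
      Rs-disjoint  : ∀ i j x → i ≢ j → x ∈ Rs i → x ∉ Rs j
      Rs-nonempty  : ∀ i → ∃[ x ] x ∈ Rs i
      Rs-nonadj    : ∀ i j x y → i ≢ j → x ∈ Rs i → y ∈ Rs j → ¬ Adj x y
      Rs-module    : ∀ i → IsModule (Rs i)
      Rs-trivperf  : ∀ i → TriviallyPerfectOn (Rs i)
      NC∩R : ∀ i x →
        (x ∈ R × x ∉ Cs i × (∃[ u ] (u ∈ Cs i × Adj u x)))
          ⇔ (∃[ j ] (toℕ i ≤ toℕ j × x ∈ Rs j))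
      NR∩C : ∀ i x →
        (x ∈ C × x ∉ Rs i × (∃[ u ] (u ∈ Rs i × Adj u x)))
          ⇔ (∃[ j ] (toℕ j ≤ toℕ i × x ∈ Cs j))
      Vf Vp : Subset n
      Vf-outside : ∀ z → z ∈ Vf → z ∉ C × z ∉ R
      Vp-outside : ∀ z → z ∈ Vp → z ∉ C × z ∉ R
      C-outer : ∀ x z → x ∈ C → z ∉ C → z ∉ R → Adj x z ⇔ (z ∈ Vp ⊎ z ∈ Vf)
      R-outer : ∀ y z → y ∈ R → z ∉ C → z ∉ R → Adj y z ⇔ z ∈ Vp

-- sum of the first p values of f (p ≤ q intended)
prefixSum : ∀ {q} → (Fin q → ℕ) → ℕ → ℕ
prefixSum {zero}  f p       = 0
prefixSum {suc q} f zero    = 0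
prefixSum {suc q} f (suc p) = f Fin.zero + prefixSum (λ i → f (Fin.suc i)) p

IsPacking : ∀ {n q} → (Fin q → Subset n) → ℕ → Subset n → Set
IsPacking {n} {q} S r P = Σ ℕ λ p →
  p ≤ q ×
  (∀ x → (x ∈ P) ⇔ (∃[ i ] (toℕ i < p × x ∈ S i))) ×
  r ≤ prefixSum (λ i → ∣ S i ∣) p ×
  (∀ p' → p' ≤ q → r ≤ prefixSum (λ i → ∣ S i ∣) p' →
     prefixSum (λ i → ∣ S i ∣) p ≤ prefixSum (λ i → ∣ S i ∣) p')

reverseSeq : ∀ {n q} → (Fin q → Subset n) → (Fin q → Subset n)
reverseSeq S i = S (opposite i)

-- Let r = 2k + 1. Every block C_i of a comb is a critical clique, so it has at
-- most k + 1 vertices; hence the shortest prefix of (C_1,…,C_l) reaching r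
-- vertices overshoots r by at most k, and likewise for (C_l,…,C_1). Either these
-- two packings together cover every block, and then |C| ≤ 2(r + k) = 6k + 2, or
-- some block C_i lies strictly between them. In the second case the two packings
-- are disjoint and miss C_i, which is nonempty (a critical clique is a maximal
-- set), so the comb is one that hypothesis (ii) forbids.
{-# OPTIONS --safe #-}
module Submission where

open import Defs
open import Data.Nat using (ℕ; zero; suc; _+_; _*_; _∸_; _≤_; _<_; z≤n; s≤s; s≤s⁻¹; _≤?_)
open import Data.Nat.Properties hiding (_≟_)
open import Data.Nat.Tactic.RingSolver using (solve-∀)
open import Data.Fin using (Fin; toℕ; opposite; inject₁; fromℕ; fromℕ<; _≟_)
open import Data.Fin.Properties using (opposite-prop; opposite-involutive; toℕ<n; toℕ-fromℕ<)
open import Data.Fin.Subset using (Subset; _∈_; _∉_; ∣_∣; _∪_; ⊥; ⁅_⁆; _⊆_)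
open import Data.Fin.Subset.Properties
  using (x∈p∪q⁻; x∈p∪q⁺; ∉⊥; ∣⊥∣≡0; p⊆q⇒∣p∣≤∣q∣; nonempty?; x∈⁅x⁆; x∈⁅y⁆⇒x≡y)
open import Data.Bool using (true; false)
open import Data.Vec using ([]; _∷_)
open import Data.Product using (Σ; ∃-syntax; _×_; _,_; proj₁)
open import Data.Sum using (_⊎_; inj₁; inj₂)
open import Data.Empty using (⊥-elim)
open import Relation.Nullary using (¬_; yes; no)
open import Relation.Binary.PropositionalEquality using (_≡_; refl; sym; trans; cong; subst; _≢_)
open import Function.Bundles using (mk⇔; Equivalence)

prefixSum-zero : ∀ {q} (f : Fin q → ℕ) → prefixSum f 0 ≡ 0
prefixSum-zero {zero}  f = refl
prefixSum-zero {suc q} f = refl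

prefixSum-one : ∀ {q} (f : Fin (suc q) → ℕ) → prefixSum f 1 ≡ f Fin.zero
prefixSum-one f rewrite prefixSum-zero (λ i → f (Fin.suc i)) = +-identityʳ (f Fin.zero)

prefixSum-mono : ∀ {q} (f : Fin q → ℕ) {p p'} → p ≤ p' → prefixSum f p ≤ prefixSum f p'
prefixSum-mono {zero}  f _ = z≤n
prefixSum-mono {suc q} f {zero} _ = z≤n
prefixSum-mono {suc q} f {suc p} {suc p'} (s≤s p≤p') =
  +-monoʳ-≤ (f Fin.zero) (prefixSum-mono (λ i → f (Fin.suc i)) p≤p')

prefixSum-inject₁ : ∀ {q} (f : Fin (suc q) → ℕ) p →
  prefixSum (λ i → f (inject₁ i)) p ≤ prefixSum f p
prefixSum-inject₁ {zero}  f p = z≤n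
prefixSum-inject₁ {suc q} f zero = z≤n
prefixSum-inject₁ {suc q} f (suc p) =
  +-monoʳ-≤ (f Fin.zero) (prefixSum-inject₁ (λ i → f (Fin.suc i)) p)

prefixSum-last : ∀ {q} (f : Fin (suc q) → ℕ) →
  prefixSum f (suc q) ≡ prefixSum (λ i → f (inject₁ i)) q + f (fromℕ q)
prefixSum-last {zero}  f = +-identityʳ (f Fin.zero)
prefixSum-last {suc q} f rewrite prefixSum-last (λ i → f (Fin.suc i)) =
  sym (+-assoc (f Fin.zero) _ _)

-- prefixSum (f ∘ opposite) p' is the sum of the last p' values of f.
prefixSum-cover : ∀ {q} (f : Fin q → ℕ) p p' → q ≤ p + p' →
  prefixSum f q ≤ prefixSum f p + prefixSum (λ i → f (opposite i)) p'
prefixSum-cover {zero}  f p p' _ = z≤n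
prefixSum-cover {suc q} f p zero q<p = begin
  prefixSum f (suc q) ≤⟨ prefixSum-mono f (subst (suc q ≤_) (+-identityʳ p) q<p) ⟩
  prefixSum f p       ≤⟨ m≤m+n _ _ ⟩
  prefixSum f p + 0   ∎
  where open ≤-Reasoning
prefixSum-cover {suc q} f p (suc p') q<p+p' = begin
  prefixSum f (suc q)                                 ≡⟨ prefixSum-last f ⟩
  prefixSum initial q + lastValue                     ≤⟨ +-monoˡ-≤ lastValue initialCovered ⟩
  (prefixSum f p + reversedInitial) + lastValue       ≡⟨ +-assoc (prefixSum f p) reversedInitial lastValue ⟩
  prefixSum f p + (reversedInitial + lastValue)       ≡⟨ cong (prefixSum f p +_) (+-comm reversedInitial lastValue) ⟩
  prefixSum f p + (lastValue + reversedInitial)       ∎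
  where
  open ≤-Reasoning
  initial = λ i → f (inject₁ i)
  lastValue = f (fromℕ q)
  reversedInitial = prefixSum (λ i → initial (opposite i)) p'
  initialCovered : prefixSum initial q ≤ prefixSum f p + reversedInitial
  initialCovered = ≤-trans
    (prefixSum-cover initial p p' (s≤s⁻¹ (subst (suc q ≤_) (+-suc p p') q<p+p')))
    (+-monoˡ-≤ reversedInitial (prefixSum-inject₁ f p))

prefixSum-total≤reverse : ∀ {q} (f : Fin q → ℕ) →
  prefixSum f q ≤ prefixSum (λ i → f (opposite i)) q
prefixSum-total≤reverse {q} f = begin
  prefixSum f q                                     ≤⟨ prefixSum-cover f 0 q ≤-refl ⟩
  prefixSum f 0 + prefixSum (λ i → f (opposite i)) q ≡⟨ cong (_+ prefixSum (λ i → f (opposite i)) q) (prefixSum-zero f) ⟩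
  prefixSum (λ i → f (opposite i)) q                ∎
  where open ≤-Reasoning

record MinimalPrefix {q} (f : Fin q → ℕ) (r slack : ℕ) : Set where
  field
    length    : ℕ
    length≤q  : length ≤ q
    reaches   : r ≤ prefixSum f length
    overshoot : prefixSum f length ≤ r + slack
    minimal   : ∀ p → r ≤ prefixSum f p → prefixSum f length ≤ prefixSum f p

minimalPrefix-cons : ∀ {k q r} (f : Fin (suc q) → ℕ) → f Fin.zero ≤ suc r →
  MinimalPrefix (λ i → f (Fin.suc i)) (suc r ∸ f Fin.zero) k → MinimalPrefix f (suc r) k
minimalPrefix-cons {k} {r = r} f first≤r P = record
  { length    = suc length
  ; length≤q  = s≤s length≤q
  ; reaches   = subst (_≤ prefixSum f (suc length)) first+rest≡r (+-monoʳ-≤ first reaches)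
  ; overshoot = subst (prefixSum f (suc length) ≤_)
                  (trans (sym (+-assoc first _ k)) (cong (_+ k) first+rest≡r)) (+-monoʳ-≤ first overshoot)
  ; minimal   = minimal′
  }
  where
  open MinimalPrefix P
  first = f Fin.zero
  first+rest≡r : first + (suc r ∸ first) ≡ suc r
  first+rest≡r = m+[n∸m]≡n first≤r
  minimal′ : ∀ p → suc r ≤ prefixSum f p → prefixSum f (suc length) ≤ prefixSum f p
  minimal′ zero    ()
  minimal′ (suc p) reached = +-monoʳ-≤ first (minimal p (m≤n+o⇒m∸n≤o (suc r) first reached))

minimalPrefix : ∀ k {q} (f : Fin q → ℕ) r → (∀ i → f i ≤ k + 1) → r ≤ prefixSum f q → MinimalPrefix f r k
minimalPrefix k f zero _ _ = record
  { length    = 0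
  ; length≤q  = z≤n
  ; reaches   = z≤n
  ; overshoot = subst (_≤ k) (sym (prefixSum-zero f)) z≤n
  ; minimal   = λ p _ → prefixSum-mono f z≤n
  }
minimalPrefix k {zero} f (suc r) _ ()
minimalPrefix k {suc q} f (suc r) bounded reachable with suc r ≤? f Fin.zero
... | yes firstReaches = record
  { length    = 1
  ; length≤q  = s≤s z≤n
  ; reaches   = subst (suc r ≤_) (sym (prefixSum-one f)) firstReaches
  ; overshoot = subst (_≤ suc r + k) (sym (prefixSum-one f))
                  (≤-trans (bounded Fin.zero) (subst (_≤ suc (r + k)) (+-comm 1 k) (s≤s (m≤n+m k r))))
  ; minimal   = minimal
  }
  where
  minimal : ∀ p → suc r ≤ prefixSum f p → prefixSum f 1 ≤ prefixSum f p
  minimal zero ()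
  minimal (suc p) _ = subst (_≤ prefixSum f (suc p)) (sym (prefixSum-one f)) (m≤m+n _ _)
... | no firstShort =
  minimalPrefix-cons f (<⇒≤ (≰⇒> firstShort))
    (minimalPrefix k (λ i → f (Fin.suc i)) (suc r ∸ f Fin.zero) (λ i → bounded (Fin.suc i))
      (m≤n+o⇒m∸n≤o (suc r) (f Fin.zero) reachable))

prefixUnion : ∀ {n q} → (Fin q → Subset n) → ℕ → Subset n
prefixUnion {q = zero}  S p       = ⊥
prefixUnion {q = suc q} S zero    = ⊥
prefixUnion {q = suc q} S (suc p) = S Fin.zero ∪ prefixUnion (λ i → S (Fin.suc i)) p

∈-prefixUnion⁺ : ∀ {n q} (S : Fin q → Subset n) p {i : Fin q} {x} →
  toℕ i < p → x ∈ S i → x ∈ prefixUnion S p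
∈-prefixUnion⁺ {q = suc q} S (suc p) {Fin.zero}  _        x∈S = x∈p∪q⁺ (inj₁ x∈S)
∈-prefixUnion⁺ {q = suc q} S (suc p) {Fin.suc i} (s≤s i<p) x∈S =
  x∈p∪q⁺ (inj₂ (∈-prefixUnion⁺ (λ j → S (Fin.suc j)) p i<p x∈S))

∈-prefixUnion⁻ : ∀ {n q} (S : Fin q → Subset n) p {x} →
  x ∈ prefixUnion S p → ∃[ i ] (toℕ i < p × x ∈ S i)
∈-prefixUnion⁻ {q = zero}  S p       x∈ = ⊥-elim (∉⊥ x∈)
∈-prefixUnion⁻ {q = suc q} S zero    x∈ = ⊥-elim (∉⊥ x∈)
∈-prefixUnion⁻ {q = suc q} S (suc p) x∈ with x∈p∪q⁻ (S Fin.zero) _ x∈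
... | inj₁ x∈S₀ = Fin.zero , s≤s z≤n , x∈S₀
... | inj₂ x∈rest with ∈-prefixUnion⁻ (λ i → S (Fin.suc i)) p x∈rest
... | i , i<p , x∈S = Fin.suc i , s≤s i<p , x∈S

∣p∪q∣≤∣p∣+∣q∣ : ∀ {n} (p q : Subset n) → ∣ p ∪ q ∣ ≤ ∣ p ∣ + ∣ q ∣
∣p∪q∣≤∣p∣+∣q∣ []          []          = z≤n
∣p∪q∣≤∣p∣+∣q∣ (false ∷ p) (false ∷ q) = ∣p∪q∣≤∣p∣+∣q∣ p q
∣p∪q∣≤∣p∣+∣q∣ (false ∷ p) (true ∷ q)  =
  subst (suc ∣ p ∪ q ∣ ≤_) (sym (+-suc ∣ p ∣ ∣ q ∣)) (s≤s (∣p∪q∣≤∣p∣+∣q∣ p q))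
∣p∪q∣≤∣p∣+∣q∣ (true ∷ p)  (false ∷ q) = s≤s (∣p∪q∣≤∣p∣+∣q∣ p q)
∣p∪q∣≤∣p∣+∣q∣ (true ∷ p)  (true ∷ q)  =
  s≤s (subst (∣ p ∪ q ∣ ≤_) (sym (+-suc ∣ p ∣ ∣ q ∣)) (m≤n⇒m≤1+n (∣p∪q∣≤∣p∣+∣q∣ p q)))

∣prefixUnion∣≤prefixSum : ∀ {n q} (S : Fin q → Subset n) p →
  ∣ prefixUnion S p ∣ ≤ prefixSum (λ i → ∣ S i ∣) p
∣prefixUnion∣≤prefixSum {n} {zero}  S p       = ≤-reflexive (∣⊥∣≡0 n)
∣prefixUnion∣≤prefixSum {n} {suc q} S zero    = ≤-reflexive (∣⊥∣≡0 n)
∣prefixUnion∣≤prefixSum {n} {suc q} S (suc p) =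
  ≤-trans (∣p∪q∣≤∣p∣+∣q∣ (S Fin.zero) _)
          (+-monoʳ-≤ ∣ S Fin.zero ∣ (∣prefixUnion∣≤prefixSum (λ i → S (Fin.suc i)) p))

MinimalPrefix-isPacking : ∀ {n q} (S : Fin q → Subset n) {r k} (P : MinimalPrefix (λ i → ∣ S i ∣) r k) →
  IsPacking S r (prefixUnion S (MinimalPrefix.length P))
MinimalPrefix-isPacking S P =
  length , length≤q
  , (λ x → mk⇔ (∈-prefixUnion⁻ S length) (λ (_ , i<p , x∈S) → ∈-prefixUnion⁺ S length i<p x∈S))
  , reaches , λ p _ → minimal p
  where open MinimalPrefix P

PairwiseDisjoint : ∀ {n q} → (Fin q → Subset n) → Set
PairwiseDisjoint S = ∀ i j x → i ≢ j → x ∈ S i → x ∉ S j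

opposite-injective : ∀ {l} {i j : Fin l} → opposite i ≡ opposite j → i ≡ j
opposite-injective {i = i} {j} e =
  trans (sym (opposite-involutive i)) (trans (cong opposite e) (opposite-involutive j))

reverseSeq-pairwiseDisjoint : ∀ {n l} {S : Fin l → Subset n} →
  PairwiseDisjoint S → PairwiseDisjoint (reverseSeq S)
reverseSeq-pairwiseDisjoint disjoint i j x i≢j =
  disjoint (opposite i) (opposite j) x (λ e → i≢j (opposite-injective e))

index<-of-∈-prefixUnion : ∀ {n l} {S : Fin l → Subset n} → PairwiseDisjoint S →
  ∀ p {i x} → x ∈ S i → x ∈ prefixUnion S p → toℕ i < p
index<-of-∈-prefixUnion {S = S} disjoint p {i} x∈Sᵢ x∈prefix with ∈-prefixUnion⁻ S p x∈prefix
... | j , j<p , x∈Sⱼ with i ≟ j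
...   | yes refl = j<p
...   | no i≢j   = ⊥-elim (disjoint i j _ i≢j x∈Sᵢ x∈Sⱼ)

index-of-∈-reversedPrefixUnion : ∀ {n l} {S : Fin l → Subset n} → PairwiseDisjoint S →
  ∀ p {i x} → x ∈ S i → x ∈ prefixUnion (reverseSeq S) p → l ≤ toℕ i + p
index-of-∈-reversedPrefixUnion {l = l} {S} disjoint p {i} x∈Sᵢ x∈suffix = begin
  l                                  ≡⟨ m+[n∸m]≡n (toℕ<n i) ⟨
  suc (toℕ i) + (l ∸ suc (toℕ i))    ≡⟨ +-suc (toℕ i) _ ⟨
  toℕ i + suc (l ∸ suc (toℕ i))      ≡⟨ cong (λ m → toℕ i + suc m) (opposite-prop i) ⟨
  toℕ i + suc (toℕ (opposite i))     ≤⟨ +-monoʳ-≤ (toℕ i) opposite<p ⟩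
  toℕ i + p                          ∎
  where
  open ≤-Reasoning
  opposite<p : toℕ (opposite i) < p
  opposite<p = index<-of-∈-prefixUnion (reverseSeq-pairwiseDisjoint disjoint) p
    (subst (λ j → _ ∈ S j) (sym (opposite-involutive i)) x∈Sᵢ) x∈suffix

record PackingGap {n l} (S : Fin l → Subset n) (r : ℕ) : Set where
  field
    front back    : Subset n
    front-packing : IsPacking S r front
    back-packing  : IsPacking (reverseSeq S) r back
    front∩back≡∅  : ∀ x → x ∈ front → x ∉ back
    gap           : Fin l
    gap-avoids    : ∀ x → x ∈ S gap → x ∉ front × x ∉ back

packings-cover-or-gap : ∀ {n l} k r (S : Fin l → Subset n) → PairwiseDisjoint S →
  (∀ i → ∣ S i ∣ ≤ k + 1) → r ≤ prefixSum (λ i → ∣ S i ∣) l →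
  prefixSum (λ i → ∣ S i ∣) l ≤ (r + k) + (r + k) ⊎ PackingGap S r
packings-cover-or-gap {l = l} k r S disjoint bounded reachable
  with minimalPrefix k (λ i → ∣ S i ∣) r bounded reachable
     | minimalPrefix k (λ i → ∣ S (opposite i) ∣) r (λ i → bounded (opposite i))
         (≤-trans reachable (prefixSum-total≤reverse (λ i → ∣ S i ∣)))
... | A | B with l ≤? MinimalPrefix.length A + MinimalPrefix.length B
...   | yes covered = inj₁ (begin
  prefixSum sizes l                       ≤⟨ prefixSum-cover sizes a b covered ⟩
  prefixSum sizes a + prefixSum sizes′ b  ≤⟨ +-mono-≤ (MinimalPrefix.overshoot A) (MinimalPrefix.overshoot B) ⟩
  (r + k) + (r + k)                       ∎)
  where
  open ≤-Reasoning
  sizes = λ i → ∣ S i ∣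
  sizes′ = λ i → sizes (opposite i)
  a = MinimalPrefix.length A
  b = MinimalPrefix.length B
...   | no gap = inj₂ record
  { front         = prefixUnion S a
  ; back          = prefixUnion (reverseSeq S) b
  ; front-packing = MinimalPrefix-isPacking S A
  ; back-packing  = MinimalPrefix-isPacking (reverseSeq S) B
  ; front∩back≡∅  = front∩back≡∅
  ; gap           = fromℕ< a<l
  ; gap-avoids    = λ x x∈gap → gap∉front x∈gap , gap∉back x∈gap
  }
  where
  a = MinimalPrefix.length A
  b = MinimalPrefix.length B
  a+b<l : a + b < l
  a+b<l = ≰⇒> gap
  a<l : a < l
  a<l = ≤-<-trans (m≤m+n a b) a+b<l
  front∩back≡∅ : ∀ x → x ∈ prefixUnion S a → x ∉ prefixUnion (reverseSeq S) b
  front∩back≡∅ x x∈front x∈back with ∈-prefixUnion⁻ S a x∈front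
  ... | i , i<a , x∈Sᵢ =
    ≤⇒≯ (index-of-∈-reversedPrefixUnion disjoint b x∈Sᵢ x∈back) (<-trans (+-monoˡ-< b i<a) a+b<l)
  gap∉front : ∀ {x} → x ∈ S (fromℕ< a<l) → x ∉ prefixUnion S a
  gap∉front x∈gap x∈front =
    <-irrefl (toℕ-fromℕ< a<l) (index<-of-∈-prefixUnion disjoint a x∈gap x∈front)
  gap∉back : ∀ {x} → x ∈ S (fromℕ< a<l) → x ∉ prefixUnion (reverseSeq S) b
  gap∉back x∈gap x∈back =
    ≤⇒≯ (subst (λ m → l ≤ m + b) (toℕ-fromℕ< a<l) (index-of-∈-reversedPrefixUnion disjoint b x∈gap x∈back)) a+b<l

-- The vertex is needed: on zero vertices the empty set is a critical clique.
criticalClique-nonempty : ∀ {n} (G : Graph n) {K} → Fin n → IsCriticalClique G K → ∃[ x ] x ∈ K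
criticalClique-nonempty G {K} y (_ , maximal) with nonempty? K
... | yes nonempty = nonempty
... | no empty = ⊥-elim (empty (y , maximal ⁅ y ⁆ K⊆⁅y⁆ singleton-twins y (x∈⁅x⁆ y)))
  where
  K⊆⁅y⁆ : ∀ x → x ∈ K → x ∈ ⁅ y ⁆
  K⊆⁅y⁆ x x∈K = ⊥-elim (empty (x , x∈K))
  singleton-twins : ∀ u v → u ∈ ⁅ y ⁆ → v ∈ ⁅ y ⁆ → SameClosedNbhd G u v
  singleton-twins u v u∈ v∈ rewrite x∈⁅y⁆⇒x≡y y u∈ | x∈⁅y⁆⇒x≡y y v∈ = λ _ → refl

module _ {n} {G : Graph n} (cb : Comb G) where
  open Comb cb

  Comb-Cs-nonempty : ∀ i → ∃[ x ] x ∈ Cs i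
  Comb-Cs-nonempty i = criticalClique-nonempty G (proj₁ (Rs-nonempty i)) (Cs-critical i)

  ∣Comb-C∣≤prefixSum : ∣ C ∣ ≤ prefixSum (λ i → ∣ Cs i ∣) l
  ∣Comb-C∣≤prefixSum = ≤-trans (p⊆q⇒∣p∣≤∣q∣ C⊆blocks) (∣prefixUnion∣≤prefixSum Cs l)
    where
    C⊆blocks : C ⊆ prefixUnion Cs l
    C⊆blocks {x} x∈C with Equivalence.to (C-partition x) x∈C
    ... | i , x∈Cᵢ = ∈-prefixUnion⁺ Cs l (toℕ<n i) x∈Cᵢ

twoPackings≡6k+2 : ∀ k → (2 * k + 1 + k) + (2 * k + 1 + k) ≡ 6 * k + 2
twoPackings≡6k+2 = solve-∀

mainTheorem7 : ∀ {n} (G : Graph n) (k : ℕ) →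
    (∀ (K : Subset n) → IsCriticalClique G K → ∣ K ∣ ≤ k + 1) →
    ¬ (Σ (Comb G) λ cb → Σ (Subset n) λ Ca → Σ (Subset n) λ Cb →
         IsPacking (Comb.Cs cb) (2 * k + 1) Ca ×
         IsPacking (reverseSeq (Comb.Cs cb)) (2 * k + 1) Cb ×
         (∀ x → x ∈ Ca → x ∉ Cb) ×
         (∃[ x ] (x ∈ Comb.C cb × x ∉ Ca × x ∉ Cb))) →
    ∀ (cb : Comb G) → ∣ Comb.C cb ∣ ≤ 6 * k + 2
mainTheorem7 G k cliqueBound irreducible cb = ≮⇒≥ ¬large
  where
  open Comb cb
  r = 2 * k + 1
  total = prefixSum (λ i → ∣ Cs i ∣) l
  large⇒r≤total : 6 * k + 2 < ∣ C ∣ → r ≤ total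
  large⇒r≤total large = begin
    r                  ≤⟨ ≤-trans (m≤m+n r k) (m≤m+n (r + k) (r + k)) ⟩
    (r + k) + (r + k)  ≡⟨ twoPackings≡6k+2 k ⟩
    6 * k + 2          ≤⟨ <⇒≤ large ⟩
    ∣ C ∣              ≤⟨ ∣Comb-C∣≤prefixSum cb ⟩
    total              ∎
    where open ≤-Reasoning
  ¬large : ¬ (6 * k + 2 < ∣ C ∣)
  ¬large large
    with packings-cover-or-gap k r Cs Cs-disjoint (λ i → cliqueBound (Cs i) (Cs-critical i)) (large⇒r≤total large)
  ... | inj₁ covered = <⇒≱ large (≤-trans (∣Comb-C∣≤prefixSum cb) (≤-trans covered (≤-reflexive (twoPackings≡6k+2 k))))
  ... | inj₂ g with Comb-Cs-nonempty cb (PackingGap.gap g)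
  ...   | x , x∈gap = irreducible
    (cb , front , back , front-packing , back-packing , front∩back≡∅
    , x , Equivalence.from (C-partition x) (gap , x∈gap) , gap-avoids x x∈gap)
    where open PackingGap g
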